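{- For all $a,b\in\mathbb Z$ we have $M_1(a)\,M_1(b)=M_1(a+b)$, where the product is the usual matrix product of $\mathbb N_0\times\mathbb N_0$ matrices over $\mathbb Z$.
   Context: For $n\in\mathbb N_0$ with binary representation $n=n_0+n_12+n_22^2+\cdots$ ($n_i\in\{0,1\}$), let $s_2(n)=n_0+n_1+n_2+\cdots$ be the binary sum of digits. For $a\in\mathbb Z\setminus\{0\}$ define the $\mathbb N_0\times\mathbb N_0$ integer matrix $M_1(a)=\big(\big(\binom{j}{i}\bmod 2\big)\,a^{s_2(j)-s_2(i)}\big)_{i,j\ge 0}$, where $\binom{j}{i}=0$ for $i>j$ and $\binom{j}{i}\bmod 2\in\{0,1\}$ is regarded as an integer (whenever $\binom{j}{i}\bmod 2=1$ one has $s_2(j)\ge s_2(i)$, so the entries are integers). Set $M_1(0)=(\delta_{i,j})_{i,j\ge0}$, the identity matrix. These matrices are upper triangular, so products involve only finite sums. -}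

module Defs where

open import Data.Nat using (ℕ; zero; suc; _∸_; _%_; _/_)
open import Data.Nat.Combinatorics using (_C_)
open import Data.Integer using (ℤ; +_; _+_; _*_; _^_)
open import Relation.Binary.PropositionalEquality using (_≡_)

Matrix : Set
Matrix = ℕ → ℕ → ℤ

-- binary digit sum, computed with fuel (fuel n suffices for input n,
-- since n has at most n binary digits)
s₂-fuel : ℕ → ℕ → ℕ
s₂-fuel zero    n = 0
s₂-fuel (suc f) n = n % 2 Data.Nat.+ s₂-fuel f (n / 2)

s₂ : ℕ → ℕ
s₂ n = s₂-fuel n n

δ : ℕ → ℕ → ℤ
δ zero    zero    = + 1
δ zero    (suc j) = + 0
δ (suc i) zero    = + 0
δ (suc i) (suc j) = δ i j

-- M₁(a) = ((binom(j,i) mod 2) · a^(s₂ j − s₂ i)); M₁(0) = identity.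
-- (Whenever binom(j,i) mod 2 = 1, s₂ j ≥ s₂ i, so truncated subtraction is exact.)
M₁ : ℤ → Matrix
M₁ (+ zero) i j = δ i j
M₁ a        i j = + ((j C i) % 2) * a ^ (s₂ j ∸ s₂ i)

sumTo : ℕ → (ℕ → ℤ) → ℤ
sumTo zero    f = f 0
sumTo (suc n) f = sumTo n f + f (suc n)

-- Matrix product of ℕ₀×ℕ₀ matrices, for upper triangular factors:
-- (A B)(i,j) = Σ_k A(i,k) B(k,j); since B(k,j) = 0 for k > j, the sum
-- is the finite sum over 0 ≤ k ≤ j.
_·_ : Matrix → Matrix → Matrix
(A · B) i j = sumTo j (λ k → A i k * B k j)

{-# OPTIONS --safe #-}
-- Write indices in binary, least significant digit first, and let
-- shear a = [[1, a], [0, 1]]. By Lucas' theorem modulo 2, (j C i) mod 2 is the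
-- product over the binary digits of the entries of the parity pattern
-- [[1, 1], [0, 1]], and s₂ j − s₂ i counts the digits where j has a 1 and i a 0;
-- hence the top-left 2ⁿ × 2ⁿ block of M₁(a) is the n-th Kronecker power of
-- shear a. Kronecker powers are multiplicative and shear a · shear b = shear (a + b);
-- since M₁ is upper triangular, the (i, j) entry of the product only involves
-- that block as soon as 2ⁿ > j.
module Submission where

open import Defs
open import Data.Nat using (ℕ)
open import Data.Integer using (ℤ; _+_)
open import Relation.Binary.PropositionalEquality using (_≡_)

open import Data.Nat as ℕ using (zero; suc; _≤_; _<_; _≤′_; z≤n; s≤s; ⌊_/2⌋; parity; _∸_; _%_; _/_)
import Data.Nat.Properties as ℕₚ
open import Data.Nat.Divisibility using (∣-refl)
open import Data.Nat.DivMod using (%-remove-+ˡ; +-distrib-/-∣ˡ)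
open import Data.Nat.Combinatorics using (_C_; nCk+nC[k+1]≡[n+1]C[k+1]; k>n⇒nCk≡0)
open import Data.Parity.Base as ℙ using (Parity; 0ℙ; 1ℙ)
import Data.Parity.Properties as ℙₚ
open import Data.Integer using (+_; -[1+_]; _*_; _^_)
import Data.Integer.Properties as ℤₚ
open import Data.Integer.Tactic.RingSolver using (solve-∀)
open import Data.Empty using (⊥-elim)
open import Relation.Binary.PropositionalEquality using (refl; sym; trans; cong; cong₂; subst; subst₂; module ≡-Reasoning)
open ≡-Reasoning

infixr 5 _∷ᵇ_

_∷ᵇ_ : Parity → ℕ → ℕ
0ℙ ∷ᵇ k = k ℕ.* 2
1ℙ ∷ᵇ k = suc (k ℕ.* 2)

parity-∷ᵇ : ∀ r k → parity (r ∷ᵇ k) ≡ r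
parity-∷ᵇ 0ℙ zero    = refl
parity-∷ᵇ 0ℙ (suc k) = parity-∷ᵇ 0ℙ k
parity-∷ᵇ 1ℙ zero    = refl
parity-∷ᵇ 1ℙ (suc k) = parity-∷ᵇ 1ℙ k

⌊∷ᵇ/2⌋ : ∀ r k → ⌊ r ∷ᵇ k /2⌋ ≡ k
⌊∷ᵇ/2⌋ 0ℙ zero    = refl
⌊∷ᵇ/2⌋ 0ℙ (suc k) = cong suc (⌊∷ᵇ/2⌋ 0ℙ k)
⌊∷ᵇ/2⌋ 1ℙ zero    = refl
⌊∷ᵇ/2⌋ 1ℙ (suc k) = cong suc (⌊∷ᵇ/2⌋ 1ℙ k)

data Halving : ℕ → Set where
  _∷_ : ∀ r k → Halving (r ∷ᵇ k)

halving : ∀ n → Halving n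
halving zero = 0ℙ ∷ 0
halving (suc n) with halving n
... | 0ℙ ∷ k = 1ℙ ∷ k
... | 1ℙ ∷ k = 0ℙ ∷ suc k

n<2k⇒⌊n/2⌋<k : ∀ {n} k → n < 2 ℕ.* k → ⌊ n /2⌋ < k
n<2k⇒⌊n/2⌋<k {n} k n<2k =
  ℕₚ.≤-trans (ℕₚ.⌊n/2⌋-mono (s≤s (subst (n <_) (ℕₚ.*-comm 2 k) n<2k)))
             (ℕₚ.≤-reflexive (⌊∷ᵇ/2⌋ 1ℙ k))

n≤1+k⇒⌊n/2⌋≤k : ∀ {n k} → n ≤ suc k → ⌊ n /2⌋ ≤ k
n≤1+k⇒⌊n/2⌋≤k {zero}  _   = z≤n
n≤1+k⇒⌊n/2⌋≤k {suc n} n≤k = ℕ.s≤s⁻¹ (ℕₚ.<-≤-trans (ℕₚ.⌊n/2⌋<n n) n≤k)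

n<2^n : ∀ n → n < 2 ℕ.^ n
n<2^n zero    = s≤s z≤n
n<2^n (suc n) = ℕₚ.+-mono-≤ (ℕₚ.m^n>0 2 n) (ℕₚ.≤-trans (n<2^n n) (ℕₚ.m≤m+n _ 0))

sumBelow : ℕ → (ℕ → ℤ) → ℤ
sumBelow zero    f = + 0
sumBelow (suc n) f = sumBelow n f + f n

sumTo≡sumBelow : ∀ j f → sumTo j f ≡ sumBelow (suc j) f
sumTo≡sumBelow zero    f = sym (ℤₚ.+-identityˡ (f 0))
sumTo≡sumBelow (suc j) f = cong (_+ f (suc j)) (sumTo≡sumBelow j f)

sumBelow-cong : ∀ n {f g} → (∀ {k} → k < n → f k ≡ g k) → sumBelow n f ≡ sumBelow n g
sumBelow-cong zero    f≡g = refl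
sumBelow-cong (suc n) f≡g = cong₂ _+_ (sumBelow-cong n (λ k<n → f≡g (ℕₚ.m<n⇒m<1+n k<n))) (f≡g ℕₚ.≤-refl)

sumBelow-*ˡ : ∀ n c f → sumBelow n (λ k → c * f k) ≡ c * sumBelow n f
sumBelow-*ˡ zero    c f = sym (ℤₚ.*-zeroʳ c)
sumBelow-*ˡ (suc n) c f = trans (cong (_+ c * f n) (sumBelow-*ˡ n c f)) (sym (ℤₚ.*-distribˡ-+ c (sumBelow n f) (f n)))

sumBelow-pairs : ∀ n f → sumBelow (0ℙ ∷ᵇ n) f ≡ sumBelow n (λ k → f (0ℙ ∷ᵇ k) + f (1ℙ ∷ᵇ k))
sumBelow-pairs zero    f = refl
sumBelow-pairs (suc n) f =
  trans (ℤₚ.+-assoc (sumBelow (0ℙ ∷ᵇ n) f) _ _) (cong (_+ (f (0ℙ ∷ᵇ n) + f (1ℙ ∷ᵇ n))) (sumBelow-pairs n f))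

sumBelow-extend : ∀ {m n} f → m ≤′ n → (∀ {k} → m ≤ k → f k ≡ + 0) → sumBelow n f ≡ sumBelow m f
sumBelow-extend f ℕ.≤′-refl                 _   = refl
sumBelow-extend f (ℕ.≤′-step {n} m≤′n) f≡0 = begin
  sumBelow n f + f n    ≡⟨ cong (λ x → sumBelow n f + x) (f≡0 (ℕₚ.≤′⇒≤ m≤′n)) ⟩
  sumBelow n f + + 0    ≡⟨ ℤₚ.+-identityʳ _ ⟩
  sumBelow n f          ≡⟨ sumBelow-extend f m≤′n f≡0 ⟩
  _                     ∎

-- Kronecker powers of 2 × 2 matrices

Matrix₂ : Set
Matrix₂ = Parity → Parity → ℤ

_·₂_ : Matrix₂ → Matrix₂ → Matrix₂
(t ·₂ u) r s = t r 0ℙ * u 0ℙ s + t r 1ℙ * u 1ℙ s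

infix 8 _^⊗_

-- The indices of t ^⊗ n are read in binary, least significant digit first;
-- entries with an index ≥ 2ⁿ vanish.
_^⊗_ : Matrix₂ → ℕ → Matrix
(t ^⊗ zero)  i j = δ i 0 * δ j 0
(t ^⊗ suc n) i j = t (parity i) (parity j) * (t ^⊗ n) ⌊ i /2⌋ ⌊ j /2⌋

^⊗-suc-∷ᵇˡ : ∀ t n r k j → (t ^⊗ suc n) (r ∷ᵇ k) j ≡ t r (parity j) * (t ^⊗ n) k ⌊ j /2⌋
^⊗-suc-∷ᵇˡ t n r k j = cong₂ (λ p m → t p (parity j) * (t ^⊗ n) m ⌊ j /2⌋) (parity-∷ᵇ r k) (⌊∷ᵇ/2⌋ r k)

^⊗-suc-∷ᵇʳ : ∀ t n i r k → (t ^⊗ suc n) i (r ∷ᵇ k) ≡ t (parity i) r * (t ^⊗ n) ⌊ i /2⌋ k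
^⊗-suc-∷ᵇʳ t n i r k = cong₂ (λ p m → t (parity i) p * (t ^⊗ n) ⌊ i /2⌋ m) (parity-∷ᵇ r k) (⌊∷ᵇ/2⌋ r k)

^⊗-mul : ∀ {t u v} → (∀ r s → (t ·₂ u) r s ≡ v r s) →
         ∀ n i j → sumBelow (2 ℕ.^ n) (λ k → (t ^⊗ n) i k * (u ^⊗ n) k j) ≡ (v ^⊗ n) i j
^⊗-mul _ zero i j =
  trans (ℤₚ.+-identityˡ _) (cong₂ _*_ (ℤₚ.*-identityʳ (δ i 0)) (ℤₚ.*-identityˡ (δ j 0)))
^⊗-mul {t} {u} {v} t·u≡v (suc n) i j = begin
    sumBelow (2 ℕ.^ suc n) f
  ≡⟨ cong (λ p → sumBelow p f) (ℕₚ.*-comm 2 (2 ℕ.^ n)) ⟩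
    sumBelow (0ℙ ∷ᵇ 2 ℕ.^ n) f
  ≡⟨ sumBelow-pairs (2 ℕ.^ n) f ⟩
    sumBelow (2 ℕ.^ n) (λ k → f (0ℙ ∷ᵇ k) + f (1ℙ ∷ᵇ k))
  ≡⟨ sumBelow-cong (2 ℕ.^ n) (λ _ → pair _) ⟩
    sumBelow (2 ℕ.^ n) (λ k → v (parity i) (parity j) * g k)
  ≡⟨ sumBelow-*ˡ (2 ℕ.^ n) (v (parity i) (parity j)) g ⟩
    v (parity i) (parity j) * sumBelow (2 ℕ.^ n) g
  ≡⟨ cong (v (parity i) (parity j) *_) (^⊗-mul t·u≡v n ⌊ i /2⌋ ⌊ j /2⌋) ⟩
    (v ^⊗ suc n) i j
  ∎
  where
  f g : ℕ → ℤ
  f k = (t ^⊗ suc n) i k * (u ^⊗ suc n) k j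
  g k = (t ^⊗ n) ⌊ i /2⌋ k * (u ^⊗ n) k ⌊ j /2⌋

  regroup : ∀ a b c d x y → (a * x) * (b * y) + (c * x) * (d * y) ≡ (a * b + c * d) * (x * y)
  regroup = solve-∀

  term : ∀ r k → f (r ∷ᵇ k) ≡ (t (parity i) r * (t ^⊗ n) ⌊ i /2⌋ k) * (u r (parity j) * (u ^⊗ n) k ⌊ j /2⌋)
  term r k = cong₂ _*_ (^⊗-suc-∷ᵇʳ t n i r k) (^⊗-suc-∷ᵇˡ u n r k j)

  pair : ∀ k → f (0ℙ ∷ᵇ k) + f (1ℙ ∷ᵇ k) ≡ v (parity i) (parity j) * g k
  pair k = begin
    f (0ℙ ∷ᵇ k) + f (1ℙ ∷ᵇ k)                   ≡⟨ cong₂ _+_ (term 0ℙ k) (term 1ℙ k) ⟩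
    _                                           ≡⟨ regroup (t (parity i) 0ℙ) (u 0ℙ (parity j)) (t (parity i) 1ℙ) (u 1ℙ (parity j))
                                                         ((t ^⊗ n) ⌊ i /2⌋ k) ((u ^⊗ n) k ⌊ j /2⌋) ⟩
    (t ·₂ u) (parity i) (parity j) * g k        ≡⟨ cong (_* g k) (t·u≡v (parity i) (parity j)) ⟩
    v (parity i) (parity j) * g k               ∎

SelfSimilar : Matrix₂ → Matrix → Set
SelfSimilar t A = ∀ i j → A i j ≡ t (parity i) (parity j) * A ⌊ i /2⌋ ⌊ j /2⌋

selfSimilar-∷ᵇ : ∀ {t A} → (∀ r s k m → A (r ∷ᵇ k) (s ∷ᵇ m) ≡ t r s * A k m) → SelfSimilar t A
selfSimilar-∷ᵇ h i j with halving i | halving j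
... | r ∷ k | s ∷ m
  rewrite parity-∷ᵇ r k | parity-∷ᵇ s m | ⌊∷ᵇ/2⌋ r k | ⌊∷ᵇ/2⌋ s m = h r s k m

selfSimilar⇒≡^⊗ : ∀ {t A} → SelfSimilar t A → (∀ i → A i 0 ≡ δ i 0) →
                  ∀ n {i j} → j < 2 ℕ.^ n → A i j ≡ (t ^⊗ n) i j
selfSimilar⇒≡^⊗ _ column zero {i} {zero} _ = trans (column i) (sym (ℤₚ.*-identityʳ (δ i 0)))
selfSimilar⇒≡^⊗ _ column zero {j = suc _} (s≤s ())
selfSimilar⇒≡^⊗ {t} {A} A-similar column (suc n) {i} {j} j<2^n = begin
  A i j                                        ≡⟨ A-similar i j ⟩
  t (parity i) (parity j) * A ⌊ i /2⌋ ⌊ j /2⌋    ≡⟨ cong (t (parity i) (parity j) *_) A≡t^⊗n ⟩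
  (t ^⊗ suc n) i j                             ∎
  where
  A≡t^⊗n : A ⌊ i /2⌋ ⌊ j /2⌋ ≡ (t ^⊗ n) ⌊ i /2⌋ ⌊ j /2⌋
  A≡t^⊗n = selfSimilar⇒≡^⊗ A-similar column n (n<2k⇒⌊n/2⌋<k (2 ℕ.^ n) j<2^n)

bit : Parity → ℕ
bit 0ℙ = 0
bit 1ℙ = 1

n%2≡bit[parity] : ∀ n → n % 2 ≡ bit (parity n)
n%2≡bit[parity] zero          = refl
n%2≡bit[parity] (suc zero)    = refl
n%2≡bit[parity] (suc (suc n)) = trans (%-remove-+ˡ n ∣-refl) (n%2≡bit[parity] n)

n/2≡⌊n/2⌋ : ∀ n → n / 2 ≡ ⌊ n /2⌋
n/2≡⌊n/2⌋ zero          = refl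
n/2≡⌊n/2⌋ (suc zero)    = refl
n/2≡⌊n/2⌋ (suc (suc n)) = trans (+-distrib-/-∣ˡ {2} n ∣-refl) (cong suc (n/2≡⌊n/2⌋ n))

s₂-fuel-suc : ∀ f n → s₂-fuel (suc f) n ≡ bit (parity n) ℕ.+ s₂-fuel f ⌊ n /2⌋
s₂-fuel-suc f n = cong₂ ℕ._+_ (n%2≡bit[parity] n) (cong (s₂-fuel f) (n/2≡⌊n/2⌋ n))

s₂-fuel-zero : ∀ f → s₂-fuel f 0 ≡ 0
s₂-fuel-zero zero    = refl
s₂-fuel-zero (suc f) = s₂-fuel-zero f

s₂-fuel-sufficient : ∀ {f g n} → n ≤ f → n ≤ g → s₂-fuel f n ≡ s₂-fuel g n
s₂-fuel-sufficient {zero}  {g}     z≤n _   = sym (s₂-fuel-zero g)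
s₂-fuel-sufficient {suc f} {zero}  _   z≤n = s₂-fuel-zero (suc f)
s₂-fuel-sufficient {suc f} {suc g} {n} n≤f n≤g = begin
  s₂-fuel (suc f) n                       ≡⟨ s₂-fuel-suc f n ⟩
  bit (parity n) ℕ.+ s₂-fuel f ⌊ n /2⌋    ≡⟨ cong (bit (parity n) ℕ.+_) halves ⟩
  bit (parity n) ℕ.+ s₂-fuel g ⌊ n /2⌋    ≡⟨ s₂-fuel-suc g n ⟨
  s₂-fuel (suc g) n                       ∎
  where
  halves : s₂-fuel f ⌊ n /2⌋ ≡ s₂-fuel g ⌊ n /2⌋
  halves = s₂-fuel-sufficient (n≤1+k⇒⌊n/2⌋≤k n≤f) (n≤1+k⇒⌊n/2⌋≤k n≤g)

s₂-step : ∀ n → s₂ n ≡ bit (parity n) ℕ.+ s₂ ⌊ n /2⌋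
s₂-step zero    = refl
s₂-step (suc n) = trans (s₂-fuel-suc n (suc n))
  (cong (bit (parity (suc n)) ℕ.+_) (s₂-fuel-sufficient {n} {⌊ suc n /2⌋} (n≤1+k⇒⌊n/2⌋≤k ℕₚ.≤-refl) ℕₚ.≤-refl))

s₂-∷ᵇ : ∀ r k → s₂ (r ∷ᵇ k) ≡ bit r ℕ.+ s₂ k
s₂-∷ᵇ r k = trans (s₂-step (r ∷ᵇ k)) (cong₂ (λ p m → bit p ℕ.+ s₂ m) (parity-∷ᵇ r k) (⌊∷ᵇ/2⌋ r k))

-- Lucas' theorem modulo 2

parity-pascal : ∀ n k → parity (suc n C suc k) ≡ parity (n C k) ℙ.+ parity (n C suc k)
parity-pascal n k = trans (cong parity (sym (nCk+nC[k+1]≡[n+1]C[k+1] n k))) (ℙₚ.+-homo-+ (n C k) (n C suc k))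

parity-[2m]C[2k]     : ∀ m k → parity ((0ℙ ∷ᵇ m) C (0ℙ ∷ᵇ k)) ≡ parity (m C k)
parity-[2m]C[1+2k]   : ∀ m k → parity ((0ℙ ∷ᵇ m) C (1ℙ ∷ᵇ k)) ≡ 0ℙ
parity-[1+2m]C[2k]   : ∀ m k → parity ((1ℙ ∷ᵇ m) C (0ℙ ∷ᵇ k)) ≡ parity (m C k)
parity-[1+2m]C[1+2k] : ∀ m k → parity ((1ℙ ∷ᵇ m) C (1ℙ ∷ᵇ k)) ≡ parity (m C k)

parity-[2m]C[2k] zero    zero    = refl
parity-[2m]C[2k] zero    (suc k) = refl
parity-[2m]C[2k] (suc m) zero    = refl
parity-[2m]C[2k] (suc m) (suc k) =
  trans (parity-pascal (1ℙ ∷ᵇ m) (1ℙ ∷ᵇ k))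
  (trans (cong₂ ℙ._+_ (parity-[1+2m]C[1+2k] m k) (parity-[1+2m]C[2k] m (suc k)))
         (sym (parity-pascal m k)))

parity-[2m]C[1+2k] zero    k = refl
parity-[2m]C[1+2k] (suc m) k =
  trans (parity-pascal (1ℙ ∷ᵇ m) (0ℙ ∷ᵇ k))
  (trans (cong₂ ℙ._+_ (parity-[1+2m]C[2k] m k) (parity-[1+2m]C[1+2k] m k))
         (ℙₚ.p+p≡0ℙ (parity (m C k))))

parity-[1+2m]C[2k] m zero    = refl
parity-[1+2m]C[2k] m (suc k) =
  trans (parity-pascal (0ℙ ∷ᵇ m) (1ℙ ∷ᵇ k))
        (cong₂ ℙ._+_ (parity-[2m]C[1+2k] m k) (parity-[2m]C[2k] m (suc k)))

parity-[1+2m]C[1+2k] m k =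
  trans (parity-pascal (0ℙ ∷ᵇ m) (0ℙ ∷ᵇ k))
  (trans (cong₂ ℙ._+_ (parity-[2m]C[2k] m k) (parity-[2m]C[1+2k] m k))
         (ℙₚ.+-identityʳ (parity (m C k))))

s₂-mono-∷ᵇ : ∀ r s k m → (parity (m C k) ≡ 1ℙ → s₂ k ≤ s₂ m) →
             parity ((s ∷ᵇ m) C (r ∷ᵇ k)) ≡ 1ℙ → s₂ (r ∷ᵇ k) ≤ s₂ (s ∷ᵇ m)
s₂-mono-∷ᵇ r s k m halves odd = subst₂ _≤_ (sym (s₂-∷ᵇ r k)) (sym (s₂-∷ᵇ s m)) (digits r s odd)
  where
  digits : ∀ r s → parity ((s ∷ᵇ m) C (r ∷ᵇ k)) ≡ 1ℙ → bit r ℕ.+ s₂ k ≤ bit s ℕ.+ s₂ m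
  digits 0ℙ 0ℙ odd = halves (trans (sym (parity-[2m]C[2k] m k)) odd)
  digits 0ℙ 1ℙ odd = ℕₚ.m≤n⇒m≤1+n (halves (trans (sym (parity-[1+2m]C[2k] m k)) odd))
  digits 1ℙ 0ℙ odd = ⊥-elim (ℙₚ.p≢p⁻¹ 0ℙ (trans (sym (parity-[2m]C[1+2k] m k)) odd))
  digits 1ℙ 1ℙ odd = s≤s (halves (trans (sym (parity-[1+2m]C[1+2k] m k)) odd))

-- The bound j < 2ⁿ is only a termination measure for the recursion on binary digits.
s₂-mono-< : ∀ n {i j} → j < 2 ℕ.^ n → parity (j C i) ≡ 1ℙ → s₂ i ≤ s₂ j
s₂-mono-< zero    {zero}  {zero}  _ _ = z≤n
s₂-mono-< zero    {suc i} {zero}  _ ()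
s₂-mono-< zero    {j = suc j} (s≤s ()) _
s₂-mono-< (suc n) {i} {j} j<2^n odd with halving i | halving j
... | r ∷ k | s ∷ m = s₂-mono-∷ᵇ r s k m (s₂-mono-< n {k} {m} m<2^n) odd
  where
  m<2^n : m < 2 ℕ.^ n
  m<2^n = subst (_< 2 ℕ.^ n) (⌊∷ᵇ/2⌋ s m) (n<2k⇒⌊n/2⌋<k (2 ℕ.^ n) j<2^n)

s₂-mono : ∀ {i j} → parity (j C i) ≡ 1ℙ → s₂ i ≤ s₂ j
s₂-mono {i} {j} = s₂-mono-< j {i} {j} (n<2^n j)

shear : ℤ → Matrix₂
shear a 0ℙ 0ℙ = + 1
shear a 0ℙ 1ℙ = a
shear a 1ℙ 0ℙ = + 0
shear a 1ℙ 1ℙ = + 1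

shear-·₂ : ∀ a b r s → (shear a ·₂ shear b) r s ≡ shear (a + b) r s
shear-·₂ a b 0ℙ 0ℙ = cong (λ x → + 1 + x) (ℤₚ.*-zeroʳ a)
shear-·₂ a b 0ℙ 1ℙ = trans (cong₂ _+_ (ℤₚ.*-identityˡ b) (ℤₚ.*-identityʳ a)) (ℤₚ.+-comm b a)
shear-·₂ a b 1ℙ 0ℙ = refl
shear-·₂ a b 1ℙ 1ℙ = refl

M₁-formula : ℤ → Matrix
M₁-formula a i j = + ((j C i) % 2) * a ^ (s₂ j ∸ s₂ i)

M₁-cases : (P : ℤ → Matrix → Set) → P (+ 0) δ → (∀ a → P a (M₁-formula a)) → ∀ a → P a (M₁ a)
M₁-cases P P-δ P-formula (+ zero)  = P-δ
M₁-cases P P-δ P-formula (+ suc n) = P-formula (+ suc n)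
M₁-cases P P-δ P-formula -[1+ n ]  = P-formula -[1+ n ]

M₁-formula-parity : ∀ a i j → M₁-formula a i j ≡ + bit (parity (j C i)) * a ^ (s₂ j ∸ s₂ i)
M₁-formula-parity a i j = cong (λ c → + c * a ^ (s₂ j ∸ s₂ i)) (n%2≡bit[parity] (j C i))

bit*^-suc∸ : ∀ a c {x y} → (c ≡ 1ℙ → y ≤ x) → + bit c * a ^ (suc x ∸ y) ≡ a * (+ bit c * a ^ (x ∸ y))
bit*^-suc∸ a 0ℙ _ = sym (ℤₚ.*-zeroʳ a)
bit*^-suc∸ a 1ℙ {x} {y} y≤x = begin
  + 1 * a ^ (suc x ∸ y)     ≡⟨ ℤₚ.*-identityˡ _ ⟩
  a ^ (suc x ∸ y)           ≡⟨ cong (a ^_) (ℕₚ.+-∸-assoc 1 (y≤x refl)) ⟩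
  a * a ^ (x ∸ y)           ≡⟨ cong (a *_) (ℤₚ.*-identityˡ _) ⟨
  a * (+ 1 * a ^ (x ∸ y))   ∎

M₁-formula-∷ᵇ : ∀ a r s k m → M₁-formula a (r ∷ᵇ k) (s ∷ᵇ m) ≡ shear a r s * M₁-formula a k m
M₁-formula-∷ᵇ a r s k m = begin
    M₁-formula a (r ∷ᵇ k) (s ∷ᵇ m)
  ≡⟨ M₁-formula-parity a (r ∷ᵇ k) (s ∷ᵇ m) ⟩
    + bit (parity ((s ∷ᵇ m) C (r ∷ᵇ k))) * a ^ (s₂ (s ∷ᵇ m) ∸ s₂ (r ∷ᵇ k))
  ≡⟨ cong (weight (parity ((s ∷ᵇ m) C (r ∷ᵇ k)))) (cong₂ _∸_ (s₂-∷ᵇ s m) (s₂-∷ᵇ r k)) ⟩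
    + bit (parity ((s ∷ᵇ m) C (r ∷ᵇ k))) * a ^ ((bit s ℕ.+ s₂ m) ∸ (bit r ℕ.+ s₂ k))
  ≡⟨ digits r s ⟩
    shear a r s * (+ bit (parity (m C k)) * a ^ (s₂ m ∸ s₂ k))
  ≡⟨ cong (shear a r s *_) (M₁-formula-parity a k m) ⟨
    shear a r s * M₁-formula a k m
  ∎
  where
  weight : Parity → ℕ → ℤ
  weight c e = + bit c * a ^ e

  digits : ∀ r s → weight (parity ((s ∷ᵇ m) C (r ∷ᵇ k))) ((bit s ℕ.+ s₂ m) ∸ (bit r ℕ.+ s₂ k))
                   ≡ shear a r s * weight (parity (m C k)) (s₂ m ∸ s₂ k)
  digits 0ℙ 0ℙ = trans (cong (λ c → weight c (s₂ m ∸ s₂ k)) (parity-[2m]C[2k] m k))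
                       (sym (ℤₚ.*-identityˡ (weight (parity (m C k)) (s₂ m ∸ s₂ k))))
  digits 0ℙ 1ℙ = trans (cong (λ c → weight c (suc (s₂ m) ∸ s₂ k)) (parity-[1+2m]C[2k] m k))
                       (bit*^-suc∸ a (parity (m C k)) (s₂-mono {k} {m}))
  digits 1ℙ 0ℙ = cong (λ c → weight c (s₂ m ∸ suc (s₂ k))) (parity-[2m]C[1+2k] m k)
  digits 1ℙ 1ℙ = trans (cong (λ c → weight c (s₂ m ∸ s₂ k)) (parity-[1+2m]C[1+2k] m k))
                       (sym (ℤₚ.*-identityˡ (weight (parity (m C k)) (s₂ m ∸ s₂ k))))

δ-selfSimilar : SelfSimilar (shear (+ 0)) δ
δ-selfSimilar zero          zero          = refl
δ-selfSimilar zero          (suc zero)    = refl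
δ-selfSimilar zero          (suc (suc j)) = sym (ℤₚ.*-zeroʳ (shear (+ 0) 0ℙ (parity j)))
δ-selfSimilar (suc zero)    zero          = refl
δ-selfSimilar (suc zero)    (suc zero)    = refl
δ-selfSimilar (suc zero)    (suc (suc j)) = sym (ℤₚ.*-zeroʳ (shear (+ 0) 1ℙ (parity j)))
δ-selfSimilar (suc (suc i)) zero          = sym (ℤₚ.*-zeroʳ (shear (+ 0) (parity i) 0ℙ))
δ-selfSimilar (suc (suc i)) (suc zero)    = sym (ℤₚ.*-zeroʳ (shear (+ 0) (parity i) 1ℙ))
δ-selfSimilar (suc (suc i)) (suc (suc j)) = δ-selfSimilar i j

M₁-selfSimilar : ∀ a → SelfSimilar (shear a) (M₁ a)
M₁-selfSimilar = M₁-cases (λ a A → SelfSimilar (shear a) A) δ-selfSimilar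
  (λ a → selfSimilar-∷ᵇ {shear a} (M₁-formula-∷ᵇ a))

M₁-first-column : ∀ a i → M₁ a i 0 ≡ δ i 0
M₁-first-column = M₁-cases (λ _ A → ∀ i → A i 0 ≡ δ i 0) (λ _ → refl) first-column
  where
  first-column : ∀ a i → M₁-formula a i 0 ≡ δ i 0
  first-column a zero    = refl
  first-column a (suc i) = refl

M₁-upper : ∀ a {i j} → j < i → M₁ a i j ≡ + 0
M₁-upper = M₁-cases (λ _ A → ∀ {i j} → j < i → A i j ≡ + 0) δ-upper
  (λ a {i} {j} j<i → cong (λ c → + (c % 2) * a ^ (s₂ j ∸ s₂ i)) (k>n⇒nCk≡0 j<i))
  where
  δ-upper : ∀ {i j} → j < i → δ i j ≡ + 0
  δ-upper {suc i} {zero}  _         = refl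
  δ-upper {suc i} {suc j} (s≤s j<i) = δ-upper j<i

M₁≡shear^⊗ : ∀ a n {i j} → j < 2 ℕ.^ n → M₁ a i j ≡ (shear a ^⊗ n) i j
M₁≡shear^⊗ a = selfSimilar⇒≡^⊗ (M₁-selfSimilar a) (M₁-first-column a)

theorem1 : (a b : ℤ) → (i j : ℕ) → (M₁ a · M₁ b) i j ≡ M₁ (a + b) i j
theorem1 a b i j = begin
    sumTo j (λ k → M₁ a i k * M₁ b k j)
  ≡⟨ sumTo≡sumBelow j _ ⟩
    sumBelow (suc j) (λ k → M₁ a i k * M₁ b k j)
  ≡⟨ sumBelow-extend _ (ℕₚ.≤⇒≤′ j<2^j) below-diagonal ⟨
    sumBelow (2 ℕ.^ j) (λ k → M₁ a i k * M₁ b k j)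
  ≡⟨ sumBelow-cong (2 ℕ.^ j) (λ k<2^j → cong₂ _*_ (M₁≡shear^⊗ a j k<2^j) (M₁≡shear^⊗ b j j<2^j)) ⟩
    sumBelow (2 ℕ.^ j) (λ k → (shear a ^⊗ j) i k * (shear b ^⊗ j) k j)
  ≡⟨ ^⊗-mul (shear-·₂ a b) j i j ⟩
    (shear (a + b) ^⊗ j) i j
  ≡⟨ M₁≡shear^⊗ (a + b) j j<2^j ⟨
    M₁ (a + b) i j
  ∎
  where
  j<2^j : j < 2 ℕ.^ j
  j<2^j = n<2^n j

  below-diagonal : ∀ {k} → j < k → M₁ a i k * M₁ b k j ≡ + 0
  below-diagonal j<k = trans (cong (M₁ a i _ *_) (M₁-upper b j<k)) (ℤₚ.*-zeroʳ (M₁ a i _))
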